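{- Let $G$ be a labeled graph and $v$ a node of minimal positive label in $G$. Let $\mathcal H$ be a finite multiset of standard components of $G$ each of which gives $v$ the label $1$, and assume $G\ominus\sum\mathcal H$ is standard. Let $H$ be the maximal standard component of $G$, and let $\mathcal H'$ be the union of $\mathcal H$ with $\ell_G(v)-|\mathcal H|$ copies of $H$. Then $\mathcal H'$ is a standard $v$-decomposition of $G$.
   Context: A labeled graph $G$: finite node set, directed edges without loops, integer labeling $\ell_G$. $G$ is standard if labels are $\ge0$ and $\ell_G(a)\le\ell_G(b)$ for each edge $(a,b)$. For graphs with the same nodes and edges, $\oplus,\ominus$ add/subtract labels nodewise; $\sum$ denotes sum of a multiset. A standard component of $G$ is a labeled graph $H$ with the same nodes and edges as $G$, labels in $\{0,1\}$, $H$ standard, $G\ominus H$ standard, not all labels of $H$ zero. The maximal standard component of a standard graph $G$ (not all labels zero) is the one with $\ell_H(w)=1$ iff $\ell_G(w)>0$. A standard $v$-decomposition of $G$ is a finite multiset $\mathcal H$ of standard components of $G$ each giving $v$ label $1$, such that $G\ominus\sum\mathcal H$ is standard and $|\mathcal H|=\ell_G(v)$. -}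

module Defs where

open import Data.Nat using (ℕ)
open import Data.Integer using (ℤ; +_; _+_; _-_; _≤_; _<_; ∣_∣)
open import Data.Integer.Properties using (_<?_)
open import Data.Fin using (Fin)
open import Data.List using (List; []; _∷_; foldr; length; replicate; _++_)
open import Data.List.Membership.Propositional using (_∈_)
open import Data.Product using (_×_; ∃)
open import Data.Sum using (_⊎_)
open import Relation.Nullary using (¬_)
open import Relation.Nullary.Decidable using (⌊_⌋)
open import Relation.Binary.PropositionalEquality using (_≡_)
open import Data.Bool using (if_then_else_)
open import Level using (0ℓ; suc)

record Graph : Set₁ where
  field
    n      : ℕ
    Edge   : Fin n → Fin n → Set
    noLoop : ∀ a → ¬ Edge a a
open Graph public

-- A labeled graph on the fixed underlying graph Γ is an integer labeling.
Labeling : Graph → Set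
Labeling Γ = Fin (n Γ) → ℤ

module _ (Γ : Graph) where

  _⊕_ : Labeling Γ → Labeling Γ → Labeling Γ
  (f ⊕ g) w = f w + g w

  _⊖_ : Labeling Γ → Labeling Γ → Labeling Γ
  (f ⊖ g) w = f w - g w

  zeroL : Labeling Γ
  zeroL _ = + 0

  Σℒ : List (Labeling Γ) → Labeling Γ
  Σℒ = foldr _⊕_ zeroL

  Standard : Labeling Γ → Set
  Standard ℓ = (∀ a → + 0 ≤ ℓ a) × (∀ a b → Edge Γ a b → ℓ a ≤ ℓ b)

  StandardComponent : Labeling Γ → Labeling Γ → Set
  StandardComponent G H =
    (∀ w → H w ≡ + 0 ⊎ H w ≡ + 1) × Standard H × Standard (G ⊖ H)
      × ¬ (∀ w → H w ≡ + 0)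

  maximalComponent : Labeling Γ → Labeling Γ
  maximalComponent G w = if ⌊ + 0 <? G w ⌋ then + 1 else + 0

  MinimalPositive : Labeling Γ → Fin (n Γ) → Set
  MinimalPositive G v = (+ 0 < G v) × (∀ w → + 0 < G w → G v ≤ G w)

  StandardVDecomposition : Labeling Γ → Fin (n Γ) → List (Labeling Γ) → Set
  StandardVDecomposition G v ℋ =
    (∀ H → H ∈ ℋ → StandardComponent G H × H v ≡ + 1)
      × Standard (G ⊖ Σℒ ℋ)
      × + length ℋ ≡ G v

module Submission where

-- Write R = G ⊖ Σℋ, M for the maximal standard component of G,
-- m = |ℋ| and k = ℓ_G(v) − m.  Both facts "M is a standard component" and
-- "R ⊖ k·M is standard" are instances of one observation: if T takes the value
-- k on a node set U and 0 elsewhere, where R ≥ k on U and R ≤ 0 off U, then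
-- T is standard whenever R is monotone, and R ⊖ T is standard whenever R is.
-- (For M take R = G and k = 1; for k·M use that R ≥ ℓ_G(v) − m = k wherever G
-- is positive, by minimality of v and since every member of ℋ is 0/1-valued,
-- and that R ≤ G ≤ 0 elsewhere.)  The file first collects facts on sums of
-- labelings, then proves this "step" lemma, specialises it to the maximal
-- component, and finally assembles the decomposition ℋ ++ k copies of M:
-- its members are components through v, its remainder is R ⊖ k·M, and its
-- size is m + k = ℓ_G(v) (standardness of G gives ℓ_G(v) ≥ 0, and
-- ℓ_G(v) ≥ m because R is nonnegative at v, where Σℋ equals m).

open import Defs
open import Data.Nat using (ℕ; _∸_)
import Data.Nat as ℕ
open import Data.Integer using (+_; -_; ∣_∣; _+_; _-_; _*_; _≤_; _<_; +≤+)
  renaming (_⊖_ to _⊖ℕ_)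
open import Data.Integer.Properties
  using (≤-refl; ≤-trans; ≤-reflexive; +-mono-≤; +-monoˡ-≤; +-monoʳ-≤; neg-mono-≤;
         +-identityˡ; +-identityʳ; *-identityʳ; *-zeroʳ; i≤j⇒i-k≤j; i≤j⇒0≤j-i;
         0≤i-j⇒j≤i; i<j⇒suc[i]≤j; suc[i]≤j⇒i<j; ≮⇒≥; <⇒≱; 0≤i⇒+∣i∣≡i; drop‿+≤+;
         ⊖-≥; m-n≡m⊖n; pos-+; _<?_)
open import Data.Integer.Tactic.RingSolver using (solve-∀)
open import Data.Fin using (Fin)
open import Data.List using (List; []; _∷_; length; replicate; _++_)
open import Data.List.Properties using (length-++; length-replicate)
open import Data.List.Membership.Propositional using (_∈_)
open import Data.List.Membership.Propositional.Properties using (∈-++⁻)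
open import Data.List.Relation.Unary.All as All using (All; []; _∷_)
open import Data.List.Relation.Unary.All.Properties using (replicate⁺)
open import Data.Product using (_×_; _,_; proj₁; proj₂)
open import Data.Sum using (_⊎_; inj₁; inj₂)
open import Relation.Nullary using (¬_; yes; no; contradiction)
open import Relation.Binary.PropositionalEquality
  using (_≡_; refl; sym; trans; cong; cong₂; subst; subst₂; module ≡-Reasoning)

∣∣∸≡- : ∀ {x} m → + 0 ≤ x → + m ≤ x → + (∣ x ∣ ∸ m) ≡ x - + m
∣∣∸≡- {x} m 0≤x m≤x = begin
  + (∣ x ∣ ∸ m)      ≡⟨ sym (⊖-≥ (drop‿+≤+ m≤∣x∣)) ⟩
  ∣ x ∣ ⊖ℕ m         ≡⟨ sym (m-n≡m⊖n ∣ x ∣ m) ⟩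
  + ∣ x ∣ - + m      ≡⟨ cong (_- + m) x≡∣x∣ ⟩
  x - + m            ∎
  where
  open ≡-Reasoning
  x≡∣x∣ : + ∣ x ∣ ≡ x
  x≡∣x∣ = 0≤i⇒+∣i∣≡i 0≤x
  m≤∣x∣ : + m ≤ + ∣ x ∣
  m≤∣x∣ = subst (+ m ≤_) (sym x≡∣x∣) m≤x

∣∣∸-split : ∀ {x} m → + 0 ≤ x → + m ≤ x → + (m ℕ.+ (∣ x ∣ ∸ m)) ≡ x
∣∣∸-split {x} m 0≤x m≤x = begin
  + (m ℕ.+ (∣ x ∣ ∸ m))   ≡⟨ pos-+ m (∣ x ∣ ∸ m) ⟩
  + m + + (∣ x ∣ ∸ m)     ≡⟨ cong (λ d → + m + d) (∣∣∸≡- m 0≤x m≤x) ⟩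
  + m + (x - + m)         ≡⟨ cancel (+ m) x ⟩
  x                       ∎
  where
  open ≡-Reasoning
  cancel : ∀ a b → a + (b - a) ≡ b
  cancel = solve-∀

module Labelings (Γ : Graph) where

  infixl 6 _⊖ᴳ_ _⊕ᴳ_

  _⊖ᴳ_ _⊕ᴳ_ : Labeling Γ → Labeling Γ → Labeling Γ
  _⊖ᴳ_ = _⊖_ Γ
  _⊕ᴳ_ = _⊕_ Γ

  Σ : List (Labeling Γ) → Labeling Γ
  Σ = Σℒ Γ

  standard-resp : ∀ {f g} → (∀ w → f w ≡ g w) → Standard Γ f → Standard Γ g
  standard-resp f≡g (nonneg , mono) =
    (λ w → subst (+ 0 ≤_) (f≡g w) (nonneg w)) ,
    (λ a b e → subst₂ _≤_ (f≡g a) (f≡g b) (mono a b e))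

  standard-⊕ : ∀ {f g} → Standard Γ f → Standard Γ g → Standard Γ (f ⊕ᴳ g)
  standard-⊕ (f-nonneg , f-mono) (g-nonneg , g-mono) =
    (λ w → +-mono-≤ (f-nonneg w) (g-nonneg w)) ,
    (λ a b e → +-mono-≤ (f-mono a b e) (g-mono a b e))

  standard-Σ : ∀ {ℋ} → All (Standard Γ) ℋ → Standard Γ (Σ ℋ)
  standard-Σ []         = (λ _ → ≤-refl) , (λ _ _ _ → ≤-refl)
  standard-Σ (H ∷ rest) = standard-⊕ H (standard-Σ rest)

  standard-from-remainder : ∀ {G F} → Standard Γ (G ⊖ᴳ F) → Standard Γ F → Standard Γ G
  standard-from-remainder {G} {F} rem-std F-std =
    standard-resp (λ w → regroup (G w) (F w)) (standard-⊕ rem-std F-std)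
    where
    regroup : ∀ x y → (x - y) + y ≡ x
    regroup = solve-∀

  Σ-++ : ∀ xs ys w → Σ (xs ++ ys) w ≡ Σ xs w + Σ ys w
  Σ-++ []       ys w = sym (+-identityˡ (Σ ys w))
  Σ-++ (x ∷ xs) ys w = begin
    x w + Σ (xs ++ ys) w         ≡⟨ cong (λ s → x w + s) (Σ-++ xs ys w) ⟩
    x w + (Σ xs w + Σ ys w)      ≡⟨ reassoc (x w) (Σ xs w) (Σ ys w) ⟩
    (x w + Σ xs w) + Σ ys w      ∎
    where
    open ≡-Reasoning
    reassoc : ∀ a b c → a + (b + c) ≡ (a + b) + c
    reassoc = solve-∀

  Σ-constant : ∀ {ℋ w c} → All (λ H → H w ≡ c) ℋ → Σ ℋ w ≡ + length ℋ * c
  Σ-constant []                     = refl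
  Σ-constant {H ∷ ℋ} {w} {c} (Hw≡c ∷ rest) = begin
    H w + Σ ℋ w                  ≡⟨ cong₂ _+_ Hw≡c (Σ-constant rest) ⟩
    c + + length ℋ * c           ≡⟨ distrib c (+ length ℋ) ⟩
    (+ 1 + + length ℋ) * c       ∎
    where
    open ≡-Reasoning
    distrib : ∀ a n → a + n * a ≡ (+ 1 + n) * a
    distrib = solve-∀

  Σ-≤-length : ∀ {ℋ w} → All (λ H → H w ≤ + 1) ℋ → Σ ℋ w ≤ + length ℋ
  Σ-≤-length []             = ≤-refl
  Σ-≤-length (Hw≤1 ∷ rest)  = +-mono-≤ Hw≤1 (Σ-≤-length rest)

  Step : ℕ → Labeling Γ → Labeling Γ → Set
  Step k R T = ∀ w → (T w ≡ + k × + k ≤ R w) ⊎ (T w ≡ + 0 × R w ≤ + 0)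

  step-nonneg : ∀ {k R T} → Step k R T → ∀ w → + 0 ≤ T w
  step-nonneg step w with step w
  ... | inj₁ (Tw≡k , _) rewrite Tw≡k = +≤+ ℕ.z≤n
  ... | inj₂ (Tw≡0 , _) rewrite Tw≡0 = ≤-refl

  step-standard : ∀ {k R T} → (∀ a b → Edge Γ a b → R a ≤ R b) → Step k R T →
                  Standard Γ T
  step-standard {k} {R} {T} R-mono step = step-nonneg step , mono
    where
    mono : ∀ a b → Edge Γ a b → T a ≤ T b
    mono a b e with step a | step b
    ... | inj₁ (Ta≡k , _) | inj₁ (Tb≡k , _) rewrite Ta≡k | Tb≡k = ≤-refl
    ... | inj₁ (Ta≡k , k≤Ra) | inj₂ (Tb≡0 , Rb≤0) rewrite Ta≡k | Tb≡0 =
      ≤-trans k≤Ra (≤-trans (R-mono a b e) Rb≤0)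
    ... | inj₂ (Ta≡0 , _) | _ rewrite Ta≡0 = step-nonneg step b

  step-⊖-standard : ∀ {k R T} → Standard Γ R → Step k R T → Standard Γ (R ⊖ᴳ T)
  step-⊖-standard {k} {R} {T} (R-nonneg , R-mono) step = nonneg , mono
    where
    nonneg : ∀ w → + 0 ≤ R w - T w
    nonneg w with step w
    ... | inj₁ (Tw≡k , k≤Rw) rewrite Tw≡k = i≤j⇒0≤j-i k≤Rw
    ... | inj₂ (Tw≡0 , _) rewrite Tw≡0 | +-identityʳ (R w) = R-nonneg w
    mono : ∀ a b → Edge Γ a b → R a - T a ≤ R b - T b
    mono a b e with step a | step b
    ... | inj₁ (Ta≡k , _) | inj₁ (Tb≡k , _) rewrite Ta≡k | Tb≡k =
      +-monoˡ-≤ (- + k) (R-mono a b e)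
    ... | inj₂ (Ta≡0 , _) | inj₂ (Tb≡0 , _) rewrite Ta≡0 | Tb≡0 =
      +-monoˡ-≤ (+ 0) (R-mono a b e)
    ... | inj₁ (Ta≡k , _) | inj₂ (Tb≡0 , _) rewrite Ta≡k | Tb≡0 | +-identityʳ (R b) =
      i≤j⇒i-k≤j (+ k) (R-mono a b e)
    ... | inj₂ (Ta≡0 , Ra≤0) | inj₁ (Tb≡k , k≤Rb) rewrite Ta≡0 | Tb≡k =
      ≤-trans (i≤j⇒i-k≤j (+ 0) Ra≤0) (i≤j⇒0≤j-i k≤Rb)

  step-on-positive : ∀ {k R T w} → Step k R T → + 0 < R w → T w ≡ + k
  step-on-positive {w = w} step 0<Rw with step w
  ... | inj₁ (Tw≡k , _)   = Tw≡k
  ... | inj₂ (_ , Rw≤0)   = contradiction Rw≤0 (<⇒≱ 0<Rw)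

  Σ-replicate : ∀ k {P : Labeling Γ} {w c} → P w ≡ c → Σ (replicate k P) w ≡ + k * c
  Σ-replicate k {P} {w} {c} Pw≡c = begin
    Σ (replicate k P) w               ≡⟨ Σ-constant (replicate⁺ k Pw≡c) ⟩
    + length (replicate k P) * c      ≡⟨ cong (λ n → + n * c) (length-replicate k) ⟩
    + k * c                           ∎
    where open ≡-Reasoning

  step-replicate : ∀ {k G R P} → Step 1 G P →
                   (∀ w → + 1 ≤ G w → + k ≤ R w) → (∀ w → R w ≤ G w) →
                   Step k R (Σ (replicate k P))
  step-replicate {k} step high low w with step w
  ... | inj₁ (Pw≡1 , 1≤Gw) =
    inj₁ (trans (Σ-replicate k Pw≡1) (*-identityʳ (+ k)) , high w 1≤Gw)
  ... | inj₂ (Pw≡0 , Gw≤0) =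
    inj₂ (trans (Σ-replicate k Pw≡0) (*-zeroʳ (+ k)) , ≤-trans (low w) Gw≤0)

  maximalComponent-step : ∀ G → Step 1 G (maximalComponent Γ G)
  maximalComponent-step G w with + 0 <? G w
  ... | yes 0<Gw = inj₁ (refl , i<j⇒suc[i]≤j 0<Gw)
  ... | no  0≮Gw = inj₂ (refl , ≮⇒≥ 0≮Gw)

  maximalComponent-component : ∀ {G v} → Standard Γ G → + 0 < G v →
                               StandardComponent Γ G (maximalComponent Γ G)
  maximalComponent-component {G} {v} G-std 0<Gv =
    zero-one , step-standard (proj₂ G-std) step , step-⊖-standard G-std step , not-all-zero
    where
    step = maximalComponent-step G
    zero-one : ∀ w → maximalComponent Γ G w ≡ + 0 ⊎ maximalComponent Γ G w ≡ + 1
    zero-one w with step w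
    ... | inj₁ (Mw≡1 , _) = inj₂ Mw≡1
    ... | inj₂ (Mw≡0 , _) = inj₁ Mw≡0
    not-all-zero : ¬ (∀ w → maximalComponent Γ G w ≡ + 0)
    not-all-zero all-zero with trans (sym (step-on-positive step 0<Gv)) (all-zero v)
    ... | ()

  component-standard : ∀ {G H} → StandardComponent Γ G H → Standard Γ H
  component-standard (_ , H-std , _) = H-std

  component-≤1 : ∀ {G H} → StandardComponent Γ G H → ∀ w → H w ≤ + 1
  component-≤1 (zero-one , _) w with zero-one w
  ... | inj₁ Hw≡0 rewrite Hw≡0 = +≤+ ℕ.z≤n
  ... | inj₂ Hw≡1 rewrite Hw≡1 = ≤-refl

  length-≤-label : ∀ {G ℋ v} → All (λ H → H v ≡ + 1) ℋ → Standard Γ (G ⊖ᴳ Σ ℋ) →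
                   + length ℋ ≤ G v
  length-≤-label {G} {ℋ} {v} through-v (rem-nonneg , _) = 0≤i-j⇒j≤i
    (subst (λ s → + 0 ≤ G v - s)
           (trans (Σ-constant through-v) (*-identityʳ (+ length ℋ)))
           (rem-nonneg v))

  remainder-≤ : ∀ {G ℋ} → (∀ w → + 0 ≤ Σ ℋ w) → ∀ w → (G ⊖ᴳ Σ ℋ) w ≤ G w
  remainder-≤ {G} 0≤Σ w =
    ≤-trans (+-monoʳ-≤ (G w) (neg-mono-≤ (0≤Σ w))) (≤-reflexive (+-identityʳ (G w)))

  remainder-lower-bound : ∀ {G ℋ v} → MinimalPositive Γ G v →
                          All (λ H → ∀ w → H w ≤ + 1) ℋ →
                          ∀ w → + 0 < G w → G v - + length ℋ ≤ (G ⊖ᴳ Σ ℋ) w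
  remainder-lower-bound (_ , minimal) ≤1 w 0<Gw =
    +-mono-≤ (minimal w 0<Gw) (neg-mono-≤ (Σ-≤-length (All.map (λ H≤1 → H≤1 w) ≤1)))

  ⊖-Σ-++ : ∀ G xs ys w → (G ⊖ᴳ Σ xs ⊖ᴳ Σ ys) w ≡ (G ⊖ᴳ Σ (xs ++ ys)) w
  ⊖-Σ-++ G xs ys w = begin
    (G w - Σ xs w) - Σ ys w      ≡⟨ regroup (G w) (Σ xs w) (Σ ys w) ⟩
    G w - (Σ xs w + Σ ys w)      ≡⟨ cong (λ s → G w - s) (sym (Σ-++ xs ys w)) ⟩
    G w - Σ (xs ++ ys) w         ∎
    where
    open ≡-Reasoning
    regroup : ∀ a b c → (a - b) - c ≡ a - (b + c)
    regroup = solve-∀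

proposition4p1 : (Γ : Graph) (G : Labeling Γ) (v : Fin (n Γ)) →
    MinimalPositive Γ G v →
    (ℋ : List (Labeling Γ)) →
    (∀ H → H ∈ ℋ → StandardComponent Γ G H × H v ≡ + 1) →
    Standard Γ (_⊖_ Γ G (Σℒ Γ ℋ)) →
    StandardVDecomposition Γ G v (ℋ ++ replicate (∣ G v ∣ ∸ length ℋ) (maximalComponent Γ G))
proposition4p1 Γ G v minimal ℋ ℋ-ok rem-std = members , remainder-std , size
  where
  open Labelings Γ
  M = maximalComponent Γ G
  m = length ℋ
  k = ∣ G v ∣ ∸ m
  comps : All (StandardComponent Γ G) ℋ
  comps = All.tabulate (λ {H} H∈ℋ → proj₁ (ℋ-ok H H∈ℋ))
  Σℋ-std : Standard Γ (Σ ℋ)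
  Σℋ-std = standard-Σ (All.map (component-standard {G}) comps)
  G-std : Standard Γ G
  G-std = standard-from-remainder {G} rem-std Σℋ-std
  m≤Gv : + m ≤ G v
  m≤Gv = length-≤-label {G} (All.tabulate (λ {H} H∈ℋ → proj₂ (ℋ-ok H H∈ℋ))) rem-std
  R-high : ∀ w → + 1 ≤ G w → + k ≤ (G ⊖ᴳ Σ ℋ) w
  R-high w 1≤Gw = subst (_≤ (G ⊖ᴳ Σ ℋ) w) (sym (∣∣∸≡- m (proj₁ G-std v) m≤Gv))
    (remainder-lower-bound {G} {ℋ} minimal (All.map (component-≤1 {G}) comps) w
                           (suc[i]≤j⇒i<j 1≤Gw))
  copies : Step k (G ⊖ᴳ Σ ℋ) (Σ (replicate k M))
  copies = step-replicate (maximalComponent-step G) R-high (remainder-≤ {G} {ℋ} (proj₁ Σℋ-std))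
  members : ∀ H → H ∈ ℋ ++ replicate k M → StandardComponent Γ G H × H v ≡ + 1
  members H H∈ with ∈-++⁻ ℋ H∈
  ... | inj₁ H∈ℋ = ℋ-ok H H∈ℋ
  ... | inj₂ H∈copies rewrite All.lookup (replicate⁺ {P = _≡ M} k refl) H∈copies =
    maximalComponent-component G-std (proj₁ minimal) ,
    step-on-positive (maximalComponent-step G) (proj₁ minimal)
  remainder-std : Standard Γ (G ⊖ᴳ Σ (ℋ ++ replicate k M))
  remainder-std = standard-resp (⊖-Σ-++ G ℋ (replicate k M)) (step-⊖-standard rem-std copies)
  size : + length (ℋ ++ replicate k M) ≡ G v
  size = trans (cong +_ (trans (length-++ ℋ) (cong (m ℕ.+_) (length-replicate k))))
               (∣∣∸-split m (proj₁ G-std v) m≤Gv)
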